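{- For any integers $d\ge 0$ and $n\ge 2(d+1)$, every $\mathbf{B}_{n,d}$-free graph $G$ satisfies $\chi(G)\le g_{n,d}(\omega(G))$; that is, the class of $\mathbf{B}_{n,d}$-free graphs is $\chi$-bounded by $g_{n,d}$.
   Context: Graphs are finite and simple; $\chi$ is the chromatic number and $\omega$ the clique number. For a set $\mathbf{H}$ of graphs, a graph is $\mathbf{H}$-free if it has no induced subgraph isomorphic to a member of $\mathbf{H}$. $G\cup H$ denotes disjoint union and $G+H$ the join ($G\cup H$ plus all edges between $G$ and $H$); for a set $\mathbf{H}$, $G\cup\mathbf{H}=\{G\cup H: H\in\mathbf{H}\}$ and $G+\mathbf{H}=\{G+H:H\in\mathbf{H}\}$. $K_m$ is the complete graph on $m$ vertices ($K_0$ empty). Define $\mathbf{B}_{n,0}$ ($n\ge2$) as the set of graphs on $n$ vertices of maximum degree $n-1$, and for $d>0$, $n\ge 2(d+1)$, \[\mathbf{B}_{n,d}=\bigcup_{m=2d}^{n-2} K_{n-m-2}+(K_2\cup \mathbf{B}_{m,d-1}).\] For $d\ge0$, $n\ge2(d+1)$, define $g_{n,d}$ on positive integers by $g_{n,d}(1)=1$; $g_{n,0}(\omega)=n-1$ for $\omega>1$; and for $d>0,\omega>1$, $g_{n,d}(\omega)=\sum_{k=1}^{\omega}(\omega-k+1)\,g_{\max(n+k-\omega-2,2d),d-1}(k)$. -}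

module Defs where

open import Data.Nat using (ℕ; zero; suc; _+_; _*_; _∸_; _⊔_; _≤_)
open import Data.Bool using (Bool; true; false; not)
open import Data.Fin using (Fin; splitAt; _≟_)
open import Data.Sum using (_⊎_; inj₁; inj₂)
open import Data.Product using (Σ; ∃; _×_; _,_)
open import Data.List using (List; length; filter; foldr; map; upTo; allFin)
open import Data.Nat.ListAction using (sum)
open import Function.Definitions using (Injective)
open import Relation.Nullary using (¬_; yes; no; Dec)
open import Relation.Nullary.Decidable using (⌊_⌋)
open import Relation.Binary.PropositionalEquality using (_≡_; _≢_; refl; sym)
open import Data.Bool.Properties using (T?)
open import Data.Bool using (T)

record Graph (n : ℕ) : Set where
  field
    adj    : Fin n → Fin n → Bool
    adjSym : ∀ i j → adj i j ≡ adj j i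
    irrefl : ∀ i → adj i i ≡ false
open Graph public

private
  neqB : ∀ {m} → Fin m → Fin m → Bool
  neqB i j = not ⌊ i ≟ j ⌋

  neqB-sym : ∀ {m} (i j : Fin m) → neqB i j ≡ neqB j i
  neqB-sym i j with i ≟ j | j ≟ i
  ... | yes _ | yes _ = refl
  ... | no _  | no _  = refl
  ... | yes p | no ¬q = Data.Empty.⊥-elim (¬q (sym p))
    where import Data.Empty
  ... | no ¬p | yes q = Data.Empty.⊥-elim (¬p (sym q))
    where import Data.Empty

  neqB-refl : ∀ {m} (i : Fin m) → neqB i i ≡ false
  neqB-refl i with i ≟ i
  ... | yes _ = refl
  ... | no ¬p = Data.Empty.⊥-elim (¬p refl)
    where import Data.Empty

K : (m : ℕ) → Graph m
K m = record { adj = neqB ; adjSym = neqB-sym ; irrefl = neqB-refl }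

-- Combining two graphs on Fin a and Fin b into a graph on Fin (a + b);
-- `cross` says whether all edges between the two parts are present.

private
  combAdj : ∀ {a b} → Bool → Graph a → Graph b → Fin (a + b) → Fin (a + b) → Bool
  combAdj {a} c G H i j with splitAt a i | splitAt a j
  ... | inj₁ x | inj₁ y = adj G x y
  ... | inj₂ x | inj₂ y = adj H x y
  ... | inj₁ _ | inj₂ _ = c
  ... | inj₂ _ | inj₁ _ = c

  combSym : ∀ {a b} c (G : Graph a) (H : Graph b) i j →
            combAdj c G H i j ≡ combAdj c G H j i
  combSym {a} c G H i j with splitAt a i | splitAt a j
  ... | inj₁ x | inj₁ y = adjSym G x y
  ... | inj₂ x | inj₂ y = adjSym H x y
  ... | inj₁ _ | inj₂ _ = refl
  ... | inj₂ _ | inj₁ _ = refl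

  combIrr : ∀ {a b} c (G : Graph a) (H : Graph b) i → combAdj c G H i i ≡ false
  combIrr {a} c G H i with splitAt a i
  ... | inj₁ x = irrefl G x
  ... | inj₂ x = irrefl H x

combine : ∀ {a b} → Bool → Graph a → Graph b → Graph (a + b)
combine c G H = record { adj = combAdj c G H ; adjSym = combSym c G H ; irrefl = combIrr c G H }

_∪ᴳ_ : ∀ {a b} → Graph a → Graph b → Graph (a + b)
G ∪ᴳ H = combine false G H

_+ᴳ_ : ∀ {a b} → Graph a → Graph b → Graph (a + b)
G +ᴳ H = combine true G H

degree : ∀ {n} → Graph n → Fin n → ℕ
degree G v = length (filter (λ u → T? (adj G v u)) (allFin _))

maxDegree : ∀ {n} → Graph n → ℕ
maxDegree G = foldr _⊔_ 0 (map (degree G) (allFin _))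

-- The families B_{n,d}:  InB d n H  means  H ∈ B_{n,d}
-- (a graph H on k vertices; membership is up to the concrete construction,
--  and freeness below is taken up to isomorphism anyway).

data InB : ℕ → ℕ → {k : ℕ} → Graph k → Set where
  base : ∀ {n} (H : Graph n) → 2 ≤ n → maxDegree H ≡ n ∸ 1 → InB 0 n H
  step : ∀ {d n m} (B : Graph m) → InB d m B →
         2 * suc d ≤ m → m ≤ n ∸ 2 →
         InB (suc d) n (K (n ∸ m ∸ 2) +ᴳ (K 2 ∪ᴳ B))

HasInduced : ∀ {N k} → Graph N → Graph k → Set
HasInduced {N} {k} G H =
  Σ (Fin k → Fin N) λ f → Injective _≡_ _≡_ f × (∀ i j → adj G (f i) (f j) ≡ adj H i j)

BFree : ℕ → ℕ → ∀ {N} → Graph N → Set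
BFree n d G = ∀ {k} (H : Graph k) → InB d n H → ¬ HasInduced G H

Colourable : ∀ {N} → Graph N → ℕ → Set
Colourable {N} G c =
  Σ (Fin N → Fin c) λ col → ∀ i j → adj G i j ≡ true → col i ≢ col j

HasClique : ∀ {N} → Graph N → ℕ → Set
HasClique {N} G w =
  Σ (Fin w → Fin N) λ f → Injective _≡_ _≡_ f × (∀ i j → i ≢ j → adj G (f i) (f j) ≡ true)

IsCliqueNumber : ∀ {N} → Graph N → ℕ → Set
IsCliqueNumber G w = HasClique G w × ¬ HasClique G (suc w)

-- g_{n,d}(ω), written  g d n ω.  (Value at ω = 0 set to 0; only relevant
-- for the empty graph.)

g : ℕ → ℕ → ℕ → ℕ
g zero    n zero          = 0
g zero    n (suc zero)    = 1
g zero    n (suc (suc _)) = n ∸ 1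
g (suc d) n zero          = 0
g (suc d) n (suc zero)    = 1
g (suc d) n (suc (suc w)) =
  sum (map (λ i → let k = suc i in (ω ∸ k + 1) * g d ((n + k ∸ (ω + 2)) ⊔ (2 * suc d)) k)
           (upTo ω))
  where ω = suc (suc w)

-- Induction on d and, for fixed d, on the clique number ω.  For d = 0, a vertex with
-- n − 1 neighbours would span, with them, a graph on n vertices of maximum degree n − 1,
-- so every degree is at most n − 2 and greedy colouring uses n − 1 colours.  For d > 0,
-- fix a maximum clique q₀ … q_{ω−1}.  Every other vertex misses some qₛ, and its first and
-- last missed positions bound its gap [lo, lo + t].  The vertices with a given gap of
-- length t contain no K_{t+2}: with the ω − t − 1 clique vertices outside the gap they
-- would form a clique of size ω + 1.  For t ≥ 1 they are also B_{n′,d−1}-free, where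
-- n′ = max(n + t + 1 − ω − 2, 2d): a copy of B ∈ B_{n′,d−1} among them, the two ends of
-- the gap (a K₂ anticomplete to B) and n − n′ − 2 clique vertices outside the gap induce
-- a member of B_{n,d}.  Clique vertices form the independent classes of gaps of length 0.
-- Colouring the ω − t classes of each length t by induction and summing gives g_{n,d}(ω).
-- The induction runs over vertex sets of G, and for a set whose clique number is below
-- the bound, monotonicity of g in ω applies.

module Submission where

open import Defs
open import Data.Nat using (ℕ; zero; suc; _+_; _*_; _∸_; _⊔_; _≤_; _<_; z≤n; s≤s; s≤s⁻¹; _≤?_; _<?_)
open import Data.Nat.Properties
open import Data.Bool using (Bool; true; false; T)
open import Data.Bool.Properties as Bool using (T?)
open import Data.Unit using (tt)
open import Data.Fin
  using (Fin; zero; suc; toℕ; punchIn; fromℕ<; splitAt; join; inject≤; finToFun; funToFin; _↑ˡ_; _↑ʳ_)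
  renaming (_≟_ to _≟ᶠ_; combine to combineᶠ)
open import Data.Fin.Properties
  using ( toℕ-injective; toℕ<n; toℕ-fromℕ<; fromℕ<-injective; inject≤-injective; join-splitAt
        ; splitAt-↑ˡ; splitAt-↑ʳ; ↑ˡ-injective; ↑ʳ-injective; combine-injective; finToFun-funToFin
        ; punchInᵢ≢i; any?; all?; ¬∀⟶∃¬; injective⇒≤ )
open import Data.Sum using (_⊎_; inj₁; inj₂; [_,_]′)
open import Data.Product using (Σ; ∃; _×_; _,_; proj₁; proj₂; map₂)
open import Data.Product.Properties using (Σ-≡,≡←≡; ≡-dec)
open import Data.List using (List; _∷_; length; map; filter; allFin; lookup; tabulate; applyUpTo)
open import Data.Nat.ListAction using (sum)
open import Data.List.Properties using (length-map; length-tabulate; filter-all; filter-notAll; foldr-preservesᵇ)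
open import Data.List.Relation.Unary.Any as Any using (index)
open import Data.List.Relation.Unary.Any.Properties using (lookup-index)
open import Data.List.Relation.Unary.All as All using (universal)
open import Data.List.Relation.Unary.All.Properties using (map⁺; tabulate⁺)
open import Data.List.Relation.Unary.AllPairs using (_∷_)
open import Data.List.Relation.Unary.Unique.Propositional using (Unique)
open import Data.List.Relation.Unary.Unique.Propositional.Properties
  using (allFin⁺) renaming (filter⁺ to unique-filter⁺)
open import Data.List.Membership.Propositional using (_∈_; _∉_)
open import Data.List.Membership.Propositional.Properties
  using (∈-filter⁺; ∈-filter⁻; ∈-allFin; ∈-lookup; ∈-map⁺)
open import Function using (_∘_; id)
open import Function.Definitions using (Injective)
open import Level using (0ℓ)
open import Relation.Nullary using (¬_; yes; no; Dec; contradiction; ¬?)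
open import Relation.Nullary.Decidable using (_×-dec_; _→-dec_; map′)
open import Relation.Unary using (Pred; Decidable; _⊆_; _∩_; U)
open import Relation.Unary.Properties using (_∩?_; U?)
open import Relation.Binary.PropositionalEquality

adj⇒≢ : ∀ {N} (G : Graph N) {x y} → adj G x y ≡ true → x ≢ y
adj⇒≢ G {x} xy refl with trans (sym xy) (irrefl G x)
... | ()

splitAt-injective : ∀ m {n} {i j : Fin (m + n)} → splitAt m i ≡ splitAt m j → i ≡ j
splitAt-injective m {n} {i} {j} eq = begin
  i                     ≡⟨ join-splitAt m n i ⟨
  join m n (splitAt m i) ≡⟨ cong (join m n) eq ⟩
  join m n (splitAt m j) ≡⟨ join-splitAt m n j ⟩
  j                     ∎
  where open ≡-Reasoning

[,]-splitAt-all : ∀ m {n} {A : Set} (P : A → Set) {f : Fin m → A} {g : Fin n → A} →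
                  (∀ u → P (f u)) → (∀ v → P (g v)) → ∀ i → P ([ f , g ]′ (splitAt m i))
[,]-splitAt-all m P all-f all-g i with splitAt m i
... | inj₁ u = all-f u
... | inj₂ v = all-g v

module _ {N} (G : Graph N) where

  record CliqueIn (S : Pred (Fin N) 0ℓ) (w : ℕ) : Set where
    field
      member     : Fin w → Fin N
      member-adj : ∀ {i j} → i ≢ j → adj G (member i) (member j) ≡ true
      member-∈   : ∀ i → S (member i)

    member-injective : Injective _≡_ _≡_ member
    member-injective {i} {j} eq with i ≟ᶠ j
    ... | yes i≡j = i≡j
    ... | no i≢j  = contradiction eq (adj⇒≢ G (member-adj i≢j))

  record InducedIn (S : Pred (Fin N) 0ℓ) {k} (H : Graph k) : Set where
    field
      embed           : Fin k → Fin N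
      embed-injective : Injective _≡_ _≡_ embed
      embed-adj       : ∀ i j → adj G (embed i) (embed j) ≡ adj H i j
      embed-∈         : ∀ i → S (embed i)

open CliqueIn public
open InducedIn public

module _ {N} {G : Graph N} {S : Pred (Fin N) 0ℓ} where

  singletonClique : ∀ {x} → S x → CliqueIn G S 1
  singletonClique {x} x∈S = record
    { member     = λ _ → x
    ; member-adj = λ { {zero} {zero} 0≢0 → contradiction refl 0≢0 }
    ; member-∈   = λ _ → x∈S
    }

  joinCliques : ∀ {a b} (C : CliqueIn G S a) (D : CliqueIn G S b) →
                (∀ u v → adj G (member C u) (member D v) ≡ true) → CliqueIn G S (a + b)
  joinCliques {a} C D cross = record
    { member = vertex ; member-adj = vertex-adj ; member-∈ = [,]-splitAt-all a S (member-∈ C) (member-∈ D) }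
    where
    vertex : Fin (a + _) → Fin N
    vertex i = [ member C , member D ]′ (splitAt a i)

    vertex-adj : ∀ {i j} → i ≢ j → adj G (vertex i) (vertex j) ≡ true
    vertex-adj {i} {j} i≢j with splitAt a i in ei | splitAt a j in ej
    ... | inj₁ u | inj₁ v = member-adj C λ { refl → i≢j (splitAt-injective a (trans ei (sym ej))) }
    ... | inj₁ u | inj₂ v = cross u v
    ... | inj₂ u | inj₁ v = trans (adjSym G _ _) (cross v u)
    ... | inj₂ u | inj₂ v = member-adj D λ { refl → i≢j (splitAt-injective a (trans ei (sym ej))) }

  clique-⊆ : ∀ {T w} → T ⊆ S → CliqueIn G T w → CliqueIn G S w
  clique-⊆ T⊆S C = record { member = member C ; member-adj = member-adj C ; member-∈ = T⊆S ∘ member-∈ C }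

  induced-⊆ : ∀ {T k} {H : Graph k} → T ⊆ S → InducedIn G T H → InducedIn G S H
  induced-⊆ T⊆S e = record
    { embed = embed e ; embed-injective = embed-injective e ; embed-adj = embed-adj e
    ; embed-∈ = T⊆S ∘ embed-∈ e }

  edgeClique : ∀ {x y} → S x → S y → adj G x y ≡ true → CliqueIn G S 2
  edgeClique x∈S y∈S xy = joinCliques (singletonClique x∈S) (singletonClique y∈S) (λ _ _ → xy)

  clique⇒induced : ∀ {w} → CliqueIn G S w → InducedIn G S (K w)
  clique⇒induced {w} C = record
    { embed = member C ; embed-injective = member-injective C ; embed-adj = adj-K ; embed-∈ = member-∈ C }
    where
    adj-K : ∀ i j → adj G (member C i) (member C j) ≡ adj (K w) i j
    adj-K i j with i ≟ᶠ j
    ... | yes refl = irrefl G (member C i)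
    ... | no i≢j   = member-adj C i≢j

  combineIn : ∀ {a b} {G₁ : Graph a} {G₂ : Graph b}
              (c : Bool) (e₁ : InducedIn G S G₁) (e₂ : InducedIn G S G₂) →
              (∀ u v → adj G (embed e₁ u) (embed e₂ v) ≡ c) → (∀ u v → embed e₁ u ≢ embed e₂ v) →
              InducedIn G S (combine c G₁ G₂)
  combineIn {a} {G₁ = G₁} {G₂} c e₁ e₂ cross disjoint = record
    { embed           = vertex
    ; embed-injective = vertex-injective
    ; embed-adj       = vertex-adj
    ; embed-∈         = [,]-splitAt-all a S (embed-∈ e₁) (embed-∈ e₂)
    }
    where
    vertex : Fin (a + _) → Fin N
    vertex i = [ embed e₁ , embed e₂ ]′ (splitAt a i)

    vertex-injective : Injective _≡_ _≡_ vertex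
    vertex-injective {i} {j} eq with splitAt a i in ei | splitAt a j in ej
    ... | inj₁ u | inj₁ v = splitAt-injective a (trans ei (trans (cong inj₁ (embed-injective e₁ eq)) (sym ej)))
    ... | inj₁ u | inj₂ v = contradiction eq (disjoint u v)
    ... | inj₂ u | inj₁ v = contradiction (sym eq) (disjoint v u)
    ... | inj₂ u | inj₂ v = splitAt-injective a (trans ei (trans (cong inj₂ (embed-injective e₂ eq)) (sym ej)))

    vertex-adj : ∀ i j → adj G (vertex i) (vertex j) ≡ adj (combine c G₁ G₂) i j
    vertex-adj i j with splitAt a i | splitAt a j
    ... | inj₁ u | inj₁ v = embed-adj e₁ u v
    ... | inj₁ u | inj₂ v = cross u v
    ... | inj₂ u | inj₁ v = trans (adjSym G _ _) (cross v u)
    ... | inj₂ u | inj₂ v = embed-adj e₂ u v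

  joinIn : ∀ {a b} {G₁ : Graph a} {G₂ : Graph b} (e₁ : InducedIn G S G₁) (e₂ : InducedIn G S G₂) →
           (∀ u v → adj G (embed e₁ u) (embed e₂ v) ≡ true) → InducedIn G S (G₁ +ᴳ G₂)
  joinIn e₁ e₂ cross = combineIn true e₁ e₂ cross λ u v → adj⇒≢ G (cross u v)

module _ {N} (G : Graph N) where

  BFreeIn : ℕ → ℕ → Pred (Fin N) 0ℓ → Set
  BFreeIn n d S = ∀ {k} (H : Graph k) → InB d n H → ¬ InducedIn G S H

  record ColouringIn (S : Pred (Fin N) 0ℓ) (C : Set) : Set where
    constructor colouring
    field
      colour : Fin N → C
      proper : ∀ {x y} → S x → S y → adj G x y ≡ true → colour x ≢ colour y

  ColourableIn : Pred (Fin N) 0ℓ → ℕ → Set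
  ColourableIn S c = ColouringIn S (Fin c)

open ColouringIn public

module _ {N} {G : Graph N} {S : Pred (Fin N) 0ℓ} where

  recolour : ∀ {C D : Set} (f : C → D) → Injective _≡_ _≡_ f → ColouringIn G S C → ColouringIn G S D
  recolour f f-injective κ = colouring (f ∘ colour κ) λ x∈S y∈S xy → proper κ x∈S y∈S xy ∘ f-injective

  colourable-≤ : ∀ {a b} → a ≤ b → ColourableIn G S a → ColourableIn G S b
  colourable-≤ a≤b = recolour (λ i → inject≤ i a≤b) (inject≤-injective _ _ _ _)

  colouring-⊆ : ∀ {T C} → T ⊆ S → ColouringIn G S C → ColouringIn G T C
  colouring-⊆ T⊆S κ = colouring (colour κ) λ x∈T y∈T → proper κ (T⊆S x∈T) (T⊆S y∈T)

  edgeless-colourable : ¬ CliqueIn G S 2 → ColourableIn G S 1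
  edgeless-colourable noEdge = colouring (λ _ → zero) λ x∈S y∈S xy _ → noEdge (edgeClique x∈S y∈S xy)

  colourByClasses : ∀ {I : Set} {C : I → Set} (class : Fin N → I) →
                    (∀ i → ColouringIn G (S ∩ λ x → class x ≡ i) (C i)) → ColouringIn G S (Σ I C)
  colourByClasses {C = C} class colourClass = colouring classColour distinct
    where
    classColour : Fin N → Σ _ C
    classColour x = class x , colour (colourClass (class x)) x

    distinct : ∀ {x y} → S x → S y → adj G x y ≡ true → classColour x ≢ classColour y
    distinct {x} {y} x∈S y∈S xy same with class x in cx | class y in cy | Σ-≡,≡←≡ same
    ... | i | .i | refl , same-i = proper (colourClass i) (x∈S , cx) (y∈S , cy) xy same-i

  hasCliqueIn? : Decidable S → ∀ w → Dec (CliqueIn G S w)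
  -- Candidate cliques are enumerated through the coding of maps Fin w → Fin N by Fin (N ^ w).
  hasCliqueIn? S? w = map′ fromCode toCode (any? (isClique? ∘ finToFun))
    where
    IsClique : (Fin w → Fin N) → Set
    IsClique f = (∀ i j → i ≢ j → adj G (f i) (f j) ≡ true) × (∀ i → S (f i))

    isClique? : ∀ f → Dec (IsClique f)
    isClique? f =
      all? (λ i → all? λ j → ¬? (i ≟ᶠ j) →-dec (adj G (f i) (f j) Bool.≟ true)) ×-dec all? (S? ∘ f)

    fromCode : (∃ λ code → IsClique (finToFun code)) → CliqueIn G S w
    fromCode (code , adjacent , inside) = record
      { member = finToFun code ; member-adj = adjacent _ _ ; member-∈ = inside }

    respects : ∀ {f f′} → (∀ i → f i ≡ f′ i) → IsClique f → IsClique f′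
    respects f≗f′ (adjacent , inside) =
      (λ i j i≢j → subst₂ (λ u v → adj G u v ≡ true) (f≗f′ i) (f≗f′ j) (adjacent i j i≢j)) ,
      (λ i → subst S (f≗f′ i) (inside i))

    toCode : CliqueIn G S w → ∃ λ code → IsClique (finToFun code)
    toCode C = funToFin (member C) ,
      respects (sym ∘ finToFun-funToFin (member C)) ((λ _ _ → member-adj C) , member-∈ C)

index-injective : ∀ {A : Set} {xs : List A} (mem : ∀ a → a ∈ xs) → Injective _≡_ _≡_ (index ∘ mem)
index-injective {xs = xs} mem {a} {b} eq =
  trans (lookup-index (mem a)) (trans (cong (lookup xs) eq) (sym (lookup-index (mem b))))

freeColour : ∀ {c} (L : List (Fin (suc c))) → length L ≤ c → ∃ λ a → a ∉ L
freeColour L L≤c with all? (λ a → Any.any? (a ≟ᶠ_) L)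
... | yes covered   = contradiction (injective⇒≤ (index-injective covered)) (<⇒≱ (s≤s L≤c))
... | no notCovered = ¬∀⟶∃¬ _ (_∈ L) (λ a → Any.any? (a ≟ᶠ_) L) notCovered

Unique⇒lookup-injective : ∀ {A : Set} {xs : List A} → Unique xs → Injective _≡_ _≡_ (lookup xs)
Unique⇒lookup-injective {xs = _ ∷ _} (_  ∷ _) {zero}  {zero}  _  = refl
Unique⇒lookup-injective {xs = _ ∷ _} (x∉ ∷ _) {zero}  {suc j} eq = contradiction eq (All.lookup x∉ (∈-lookup j))
Unique⇒lookup-injective {xs = _ ∷ _} (x∉ ∷ _) {suc i} {zero}  eq =
  contradiction (sym eq) (All.lookup x∉ (∈-lookup i))
Unique⇒lookup-injective {xs = _ ∷ _} (_  ∷ u) {suc i} {suc j} eq = cong suc (Unique⇒lookup-injective u eq)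

module _ {N} (G : Graph N) {S : Pred (Fin N) 0ℓ} (S? : Decidable S) where

  neighbourIn? : ∀ x → Decidable (S ∩ λ y → adj G x y ≡ true)
  neighbourIn? x = S? ∩? λ y → adj G x y Bool.≟ true

  neighboursIn : Fin N → List (Fin N)
  neighboursIn x = filter (neighbourIn? x) (allFin N)

  ∈-neighboursIn⁺ : ∀ {x y} → S y → adj G x y ≡ true → y ∈ neighboursIn x
  ∈-neighboursIn⁺ {x} y∈S xy = ∈-filter⁺ (neighbourIn? x) {xs = allFin N} (∈-allFin _) (y∈S , xy)

  ∈-neighboursIn⁻ : ∀ {x y} → y ∈ neighboursIn x → S y × adj G x y ≡ true
  ∈-neighboursIn⁻ {x} {y} y∈ = proj₂ (∈-filter⁻ (neighbourIn? x) {y} {allFin N} y∈)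

  neighboursIn-unique : ∀ x → Unique (neighboursIn x)
  neighboursIn-unique x = unique-filter⁺ (neighbourIn? x) (allFin⁺ N)

  greedy-colourable : ∀ {c} → (∀ {x} → S x → length (neighboursIn x) ≤ c) → ColourableIn G S (suc c)
  greedy-colourable {c} sparse = colouring-⊆ (λ {x} x∈S → x∈S , toℕ<n x) (prefix N)
    where
    Prefix : ℕ → Pred (Fin N) 0ℓ
    Prefix k = S ∩ λ x → toℕ x < k

    prefix : ∀ k → ColourableIn G (Prefix k) (suc c)
    prefix zero    = colouring (λ _ → zero) λ { (_ , ()) }
    prefix (suc k) = colouring extended distinct
      where
      previous : Fin N → Fin (suc c)
      previous = colour (prefix k)

      -- The new vertex avoids the current colours of all its neighbours in S, although only
      -- those of its earlier neighbours are final.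
      fresh : Fin N → Fin (suc c)
      fresh x with S? x
      ... | yes x∈S = proj₁ (freeColour (map previous (neighboursIn x))
                                        (subst (_≤ c) (sym (length-map previous (neighboursIn x))) (sparse x∈S)))
      ... | no _    = zero

      fresh-∉ : ∀ {x} → S x → fresh x ∉ map previous (neighboursIn x)
      fresh-∉ {x} x∈S with S? x
      ... | yes _    = proj₂ (freeColour _ _)
      ... | no x∉S   = contradiction x∈S x∉S

      extended : Fin N → Fin (suc c)
      extended x with toℕ x ≟ k
      ... | yes _ = fresh x
      ... | no _  = previous x

      earlier : ∀ {x} → Prefix (suc k) x → toℕ x ≢ k → Prefix k x
      earlier (x∈S , x<1+k) x≢k with m<1+n⇒m<n∨m≡n x<1+k
      ... | inj₁ x<k = x∈S , x<k
      ... | inj₂ x≡k = contradiction x≡k x≢k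

      fresh≢previous : ∀ {x y} → S x → Prefix k y → adj G x y ≡ true → fresh x ≢ previous y
      fresh≢previous x∈S (y∈S , _) xy same =
        fresh-∉ x∈S (subst (_∈ _) (sym same) (∈-map⁺ previous (∈-neighboursIn⁺ y∈S xy)))

      distinct : ∀ {x y} → Prefix (suc k) x → Prefix (suc k) y → adj G x y ≡ true → extended x ≢ extended y
      distinct {x} {y} x∈ y∈ xy with toℕ x ≟ k | toℕ y ≟ k
      ... | yes x≡k | yes y≡k = λ _ → adj⇒≢ G xy (toℕ-injective (trans x≡k (sym y≡k)))
      ... | yes _   | no y≢k  = fresh≢previous (proj₁ x∈) (earlier y∈ y≢k) xy
      ... | no x≢k  | yes _   = fresh≢previous (proj₁ y∈) (earlier x∈ x≢k) (trans (adjSym G y x) xy) ∘ sym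
      ... | no x≢k  | no y≢k  = proper (prefix k) (earlier x∈ x≢k) (earlier y∈ y≢k) xy

inducedBy : ∀ {N k} → Graph N → (Fin k → Fin N) → Graph k
inducedBy G f = record
  { adj = λ i j → adj G (f i) (f j) ; adjSym = λ i j → adjSym G (f i) (f j) ; irrefl = λ i → irrefl G (f i) }

inducedBy-InducedIn : ∀ {N k} {G : Graph N} {S : Pred (Fin N) 0ℓ} {f : Fin k → Fin N} →
                      Injective _≡_ _≡_ f → (∀ i → S (f i)) → InducedIn G S (inducedBy G f)
inducedBy-InducedIn {f = f} f-injective inside = record
  { embed = f ; embed-injective = f-injective ; embed-adj = λ _ _ → refl ; embed-∈ = inside }

degree≤ : ∀ {k} (H : Graph (suc k)) v → degree H v ≤ k
degree≤ {k} H v = s≤s⁻¹ (subst (degree H v <_) (length-tabulate id)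
  (filter-notAll (T? ∘ adj H v) (allFin (suc k)) (Any.map (λ { refl → subst T (irrefl H v) }) (∈-allFin v))))

maxDegree-dominated : ∀ {k} (H : Graph (suc k)) → (∀ i → adj H zero (suc i) ≡ true) → maxDegree H ≡ k
maxDegree-dominated {k} H dominating = ≤-antisym
  (foldr-preservesᵇ {P = _≤ k} {f = _⊔_} ⊔-lub z≤n (map⁺ (universal (degree≤ H) (allFin (suc k)))))
  (subst (_≤ maxDegree H) degree-zero (m≤m⊔n _ _))
  where
  degree-zero : degree H zero ≡ k
  degree-zero rewrite irrefl H zero = begin
    length (filter (T? ∘ adj H zero) (tabulate suc)) ≡⟨ cong length (filter-all (T? ∘ adj H zero)
                                                          (tabulate⁺ λ i → subst T (sym (dominating i)) tt)) ⟩
    length (tabulate {n = k} suc)                 ≡⟨ length-tabulate suc ⟩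
    k                                             ∎
    where open ≡-Reasoning

module _ {N} (G : Graph N) {S : Pred (Fin N) 0ℓ} (S? : Decidable S) where

  BFree⇒sparse : ∀ {c} → BFreeIn G (suc (suc c)) 0 S → ∀ {x} → S x → length (neighboursIn G S? x) ≤ c
  BFree⇒sparse {c} free {x} x∈S with length (neighboursIn G S? x) ≤? c
  ... | yes sparse = sparse
  ... | no dense = contradiction (inducedBy-InducedIn ball-injective ball-∈) (free (inducedBy G ball) ball∈B)
    where
    L : List (Fin N)
    L = neighboursIn G S? x

    leaf : Fin (suc c) → Fin N
    leaf i = lookup L (inject≤ i (≰⇒> dense))

    leaf-∈ : ∀ i → S (leaf i) × adj G x (leaf i) ≡ true
    leaf-∈ i = ∈-neighboursIn⁻ G S? (∈-lookup _)

    ball : Fin (suc (suc c)) → Fin N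
    ball zero    = x
    ball (suc i) = leaf i

    ball-∈ : ∀ i → S (ball i)
    ball-∈ zero    = x∈S
    ball-∈ (suc i) = proj₁ (leaf-∈ i)

    ball∈B : InB 0 (suc (suc c)) (inducedBy G ball)
    ball∈B = base _ (s≤s (s≤s z≤n)) (maxDegree-dominated (inducedBy G ball) (proj₂ ∘ leaf-∈))

    ball-injective : Injective _≡_ _≡_ ball
    ball-injective {zero}  {zero}  _  = refl
    ball-injective {zero}  {suc j} eq = contradiction eq (adj⇒≢ G (proj₂ (leaf-∈ j)))
    ball-injective {suc i} {zero}  eq = contradiction (sym eq) (adj⇒≢ G (proj₂ (leaf-∈ i)))
    ball-injective {suc i} {suc j} eq =
      cong suc (inject≤-injective _ _ i j (Unique⇒lookup-injective (neighboursIn-unique G S? x) eq))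

sum-applyUpTo-mono : ∀ m {f f′ F F′ : ℕ → ℕ} → (∀ i → F (f i) ≤ F′ (f′ i)) →
                     sum (map F (applyUpTo f m)) ≤ sum (map F′ (applyUpTo f′ m))
sum-applyUpTo-mono zero    _  = z≤n
sum-applyUpTo-mono (suc m) le = +-mono-≤ (le 0) (sum-applyUpTo-mono m (le ∘ suc))

sumIndex : ∀ {m} (F f : ℕ → ℕ) (t : Fin m) → Fin (F (f (toℕ t))) → Fin (sum (map F (applyUpTo f m)))
sumIndex F f zero    i = i ↑ˡ _
sumIndex F f (suc t) i = F (f 0) ↑ʳ sumIndex F (f ∘ suc) t i

sumIndex-injective : ∀ {m} (F f : ℕ → ℕ) {t t′ : Fin m} {i i′} →
                     sumIndex F f t i ≡ sumIndex F f t′ i′ →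
                     _≡_ {A = Σ (Fin m) (Fin ∘ F ∘ f ∘ toℕ)} (t , i) (t′ , i′)
sumIndex-injective F f {zero}  {zero}   eq = cong (zero ,_) (↑ˡ-injective _ _ _ eq)
sumIndex-injective F f {zero}  {suc t′} {i} {i′} eq
  with () ← trans (sym (splitAt-↑ˡ _ i _)) (trans (cong (splitAt _) eq) (splitAt-↑ʳ (F (f 0)) _ _))
sumIndex-injective F f {suc t} {zero}   {i} {i′} eq
  with () ← trans (sym (splitAt-↑ʳ (F (f 0)) _ _)) (trans (cong (splitAt _) eq) (splitAt-↑ˡ _ i′ _))
sumIndex-injective F f {suc t} {suc t′} eq =
  cong (λ { (t , i) → suc t , i }) (sumIndex-injective F (f ∘ suc) (↑ʳ-injective _ _ _ eq))

g-one : ∀ d n → g d n 1 ≡ 1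
g-one zero    n = refl
g-one (suc d) n = refl

2≤2*suc : ∀ d → 2 ≤ 2 * suc d
2≤2*suc d = *-monoʳ-≤ 2 (s≤s z≤n)

-- For gaps of length k = t + 1: the order max(n + k − ω − 2, 2d) of the smaller families,
-- and the k-th term of the sum defining g (suc d) n ω.
reducedOrder : ℕ → ℕ → ℕ → ℕ → ℕ
reducedOrder d n ω t = (n + suc t ∸ (ω + 2)) ⊔ 2 * suc d

summand : ℕ → ℕ → ℕ → ℕ → ℕ
summand d n ω t = (ω ∸ suc t + 1) * g d (reducedOrder d n ω t) (suc t)

g-mono : ∀ d {n} w → 2 ≤ n → g d n (suc w) ≤ g d n (suc (suc w))
g-mono zero    {suc (suc _)} zero    _         = s≤s z≤n
g-mono zero    {suc zero}    zero    (s≤s ())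
g-mono zero                  (suc w) _         = ≤-refl
g-mono (suc d) {n}           zero    _ rewrite g-one d ((n + 1 ∸ 4) ⊔ 2 * suc d) = s≤s z≤n
g-mono (suc d) {n}           (suc w) _ =
  ≤-trans (sum-applyUpTo-mono ω {f = id} {suc} {summand d n ω} {summand d n (suc ω)} summand≤)
          (m≤n+m _ (summand d n (suc ω) 0))
  where
  ω : ℕ
  ω = suc (suc w)
  summand≤ : ∀ i → summand d n ω i ≤ summand d n (suc ω) (suc i)
  summand≤ i rewrite +-suc n (suc i) =
    *-monoʳ-≤ (ω ∸ suc i + 1) (g-mono d i (≤-trans (2≤2*suc d) (m≤n⊔m _ _)))

InB-order : ∀ {d n k} {H : Graph k} → InB d n H → k ≡ n
InB-order (base _ _ _) = refl
InB-order {n = n} (step {d} {m = m} _ _ 2d≤m m≤n∸2) = begin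
  n ∸ m ∸ 2 + (2 + m)   ≡⟨ cong₂ _+_ (∸-+-assoc n m 2) (+-comm 2 m) ⟩
  n ∸ (m + 2) + (m + 2) ≡⟨ m∸n+n≡m m+2≤n ⟩
  n                     ∎
  where
  open ≡-Reasoning
  m+2≤n : m + 2 ≤ n
  m+2≤n = m≤o∸n⇒m+n≤o m (≤-trans (≤-trans (2≤2*suc d) 2d≤m) (≤-trans m≤n∸2 (m∸n≤m n 2)))
                        m≤n∸2

reducedOrder≤ : ∀ d {n ω t} → suc t ≤ ω → 2 * suc (suc d) ≤ n → reducedOrder d n ω t ≤ n ∸ 2
reducedOrder≤ d {n} {ω} {t} t<ω 2d+2≤n = ⊔-lub
  (begin
    n + suc t ∸ (ω + 2) ≤⟨ ∸-monoˡ-≤ (ω + 2) (+-monoʳ-≤ n t<ω) ⟩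
    n + ω ∸ (ω + 2)     ≡⟨ cong (_∸ (ω + 2)) (+-comm n ω) ⟩
    ω + n ∸ (ω + 2)     ≡⟨ [m+n]∸[m+o]≡n∸o ω n 2 ⟩
    n ∸ 2               ∎)
  (m+n≤o⇒m≤o∸n (2 * suc d) (subst (_≤ n) (trans (*-suc 2 (suc d)) (+-comm 2 (2 * suc d))) 2d+2≤n))
  where open ≤-Reasoning

reducedOrder-room : ∀ d n {ω t} → suc t ≤ ω → n ∸ reducedOrder d n ω t ∸ 2 + suc t ≤ ω
reducedOrder-room d n {ω} {t} t<ω = begin
  n ∸ n′ ∸ 2 + suc t   ≡⟨ cong (_+ suc t) (∸-+-assoc n n′ 2) ⟩
  n ∸ (n′ + 2) + suc t ≤⟨ +-monoˡ-≤ (suc t) (m≤n+o⇒m∸n≤o n (n′ + 2) n≤) ⟩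
  ω ∸ suc t + suc t    ≡⟨ m∸n+n≡m t<ω ⟩
  ω                    ∎
  where
  open ≤-Reasoning
  n′ : ℕ
  n′ = reducedOrder d n ω t
  n≤ : n ≤ n′ + 2 + (ω ∸ suc t)
  n≤ = begin
    n                                     ≡⟨ m+n∸n≡m n (suc t) ⟨
    n + suc t ∸ suc t                     ≤⟨ ∸-monoˡ-≤ (suc t) (m≤n+m∸n (n + suc t) (ω + 2)) ⟩
    ω + 2 + (n + suc t ∸ (ω + 2)) ∸ suc t ≤⟨ ∸-monoˡ-≤ (suc t) (+-monoʳ-≤ (ω + 2) (m≤m⊔n _ (2 * suc d))) ⟩
    ω + 2 + n′ ∸ suc t                    ≡⟨ cong (_∸ suc t) (+-comm (ω + 2) n′) ⟩
    n′ + (ω + 2) ∸ suc t                  ≡⟨ cong (λ z → n′ + z ∸ suc t) (+-comm ω 2) ⟩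
    n′ + (2 + ω) ∸ suc t                  ≡⟨ cong (_∸ suc t) (+-assoc n′ 2 ω) ⟨
    n′ + 2 + ω ∸ suc t                    ≡⟨ +-∸-assoc (n′ + 2) t<ω ⟩
    n′ + 2 + (ω ∸ suc t)                  ∎

least-counterexample : ∀ {n} {P : Pred (Fin n) 0ℓ} → Decidable P → ¬ (∀ i → P i) →
                       ∃ λ i → ¬ P i × (∀ j → toℕ j < toℕ i → P j)
least-counterexample {zero}  P? ¬∀P = contradiction (λ ()) ¬∀P
least-counterexample {suc n} P? ¬∀P with P? zero
... | no ¬P₀ = zero , ¬P₀ , λ _ ()
... | yes P₀ with least-counterexample (P? ∘ suc) (λ ∀P → ¬∀P λ { zero → P₀ ; (suc i) → ∀P i })
...   | i , ¬Pi , below = suc i , ¬Pi , λ { zero _ → P₀ ; (suc j) j<i → below j (s≤s⁻¹ j<i) }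

greatest-counterexample : ∀ {n} {P : Pred (Fin n) 0ℓ} → Decidable P → ¬ (∀ i → P i) →
                          ∃ λ i → ¬ P i × (∀ j → toℕ i < toℕ j → P j)
greatest-counterexample {zero}  P? ¬∀P = contradiction (λ ()) ¬∀P
greatest-counterexample {suc n} P? ¬∀P with all? (P? ∘ suc)
... | yes ∀P₊ = zero , (λ P₀ → ¬∀P λ { zero → P₀ ; (suc i) → ∀P₊ i }) ,
                λ { zero () ; (suc j) _ → ∀P₊ j }
... | no ¬∀P₊ with greatest-counterexample (P? ∘ suc) ¬∀P₊
...   | i , ¬Pi , above = suc i , ¬Pi , λ { zero () ; (suc j) i<j → above j (s≤s⁻¹ i<j) }

-- An interval [lo, lo + len] ⊆ [0, ω).  For each length there are ω − len choices of lo,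
-- written ω ∸ (len + 1) + 1 as in g.
Interval : ℕ → Set
Interval ω = Σ (Fin ω) λ len → Fin (ω ∸ suc (toℕ len) + 1)

module _ {ω : ℕ} (c : Interval ω) where

  len lo hi : ℕ
  len = toℕ (proj₁ c)
  lo  = toℕ (proj₂ c)
  hi  = lo + len

  hi<ω : hi < ω
  hi<ω = subst (_≤ ω) (+-suc lo len)
    (m≤o∸n⇒m+n≤o lo (toℕ<n (proj₁ c)) (s≤s⁻¹ (subst (lo <_) (+-comm _ 1) (toℕ<n (proj₂ c)))))

  first last : Fin ω
  first = fromℕ< (≤-<-trans (m≤m+n lo len) hi<ω)
  last  = fromℕ< hi<ω

  Outside : Fin ω → Set
  Outside s = toℕ s < lo ⊎ hi < toℕ s

  Outside⇒≢first : ∀ {s} → Outside s → s ≢ first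
  Outside⇒≢first (inj₁ s<lo) refl = <-irrefl (toℕ-fromℕ< _) s<lo
  Outside⇒≢first (inj₂ hi<s) refl = <-irrefl (sym (toℕ-fromℕ< _)) (≤-<-trans (m≤m+n lo len) hi<s)

  Outside⇒≢last : ∀ {s} → Outside s → s ≢ last
  Outside⇒≢last (inj₁ s<lo) refl = <-irrefl (toℕ-fromℕ< _) (<-≤-trans s<lo (m≤m+n lo len))
  Outside⇒≢last (inj₂ hi<s) refl = <-irrefl (sym (toℕ-fromℕ< _)) hi<s

  first≢last : len ≢ 0 → first ≢ last
  first≢last len≢0 eq =
    <⇒≢ (m<m+n lo (n≢0⇒n>0 len≢0)) (trans (sym (toℕ-fromℕ< _)) (trans (cong toℕ eq) (toℕ-fromℕ< _)))

interval : ∀ {ω} (l t : ℕ) → l + t < ω → Interval ω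
interval {ω} l t l+t<ω = fromℕ< t<ω , fromℕ< (subst (λ u → l < ω ∸ suc u + 1) (sym (toℕ-fromℕ< t<ω)) l<)
  where
  t<ω : t < ω
  t<ω = ≤-<-trans (m≤n+m t l) l+t<ω
  l< : l < ω ∸ suc t + 1
  l< = ≤-<-trans (m+n≤o⇒m≤o∸n l (subst (_≤ ω) (sym (+-suc l t)) l+t<ω)) (m<m+n _ (s≤s z≤n))

point : ∀ {ω} (s : Fin ω) → Σ (Interval ω) λ c → len c ≡ 0 × first c ≡ s
point {ω} s =
  interval (toℕ s) 0 s+0<ω , toℕ-fromℕ< _ , toℕ-injective (trans (toℕ-fromℕ< _) (toℕ-fromℕ< _))
  where
  s+0<ω : toℕ s + 0 < ω
  s+0<ω = subst (_< ω) (sym (+-identityʳ _)) (toℕ<n s)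

between : ∀ {ω} (i j : Fin ω) → toℕ i ≤ toℕ j →
          Σ (Interval ω) λ c → first c ≡ i × last c ≡ j ×
                               (∀ {s} → Outside c s → toℕ s < toℕ i ⊎ toℕ j < toℕ s)
between {ω} i j i≤j =
  c , toℕ-injective (trans (toℕ-fromℕ< _) lo≡i) , toℕ-injective (trans (toℕ-fromℕ< _) hi≡j) , bounds
  where
  i+[j∸i]≡j : toℕ i + (toℕ j ∸ toℕ i) ≡ toℕ j
  i+[j∸i]≡j = m+[n∸m]≡n i≤j
  c : Interval ω
  c = interval (toℕ i) (toℕ j ∸ toℕ i) (subst (_< ω) (sym i+[j∸i]≡j) (toℕ<n j))
  lo≡i : lo c ≡ toℕ i
  lo≡i = toℕ-fromℕ< _
  hi≡j : hi c ≡ toℕ j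
  hi≡j = trans (cong₂ _+_ lo≡i (toℕ-fromℕ< _)) i+[j∸i]≡j
  bounds : ∀ {s} → Outside c s → toℕ s < toℕ i ⊎ toℕ j < toℕ s
  bounds (inj₁ s<lo) = inj₁ (subst (_ <_) lo≡i s<lo)
  bounds (inj₂ hi<s) = inj₂ (subst (_< _) hi≡j hi<s)

-- skip lo len enumerates ℕ ∖ [lo, lo + len] in increasing order.
skip : ℕ → ℕ → ℕ → ℕ
skip lo len u with u <? lo
... | yes _ = u
... | no  _ = suc (u + len)

skip-avoids : ∀ lo len u → skip lo len u < lo ⊎ lo + len < skip lo len u
skip-avoids lo len u with u <? lo
... | yes u<lo = inj₁ u<lo
... | no  u≮lo = inj₂ (s≤s (+-monoˡ-≤ len (≮⇒≥ u≮lo)))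

skip-bounded : ∀ lo len {u m ω} → u < m → m + suc len ≤ ω → skip lo len u < ω
skip-bounded lo len {u} {m} u<m room with u <? lo
... | yes _ = <-≤-trans u<m (≤-trans (m≤m+n m (suc len)) room)
... | no  _ = ≤-trans (s≤s (≤-reflexive (sym (+-suc u len)))) (≤-trans (+-monoˡ-≤ (suc len) u<m) room)

m<n≤o⇒m≢1+o+p : ∀ {m n o} p → m < n → n ≤ o → m ≢ suc (o + p)
m<n≤o⇒m≢1+o+p p m<n n≤o refl =
  <-irrefl refl (<-≤-trans m<n (≤-trans n≤o (≤-trans (m≤m+n _ p) (n≤1+n _))))

skip-injective : ∀ lo len {u v} → skip lo len u ≡ skip lo len v → u ≡ v
skip-injective lo len {u} {v} eq with u <? lo | v <? lo
... | yes _    | yes _    = eq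
... | no  _    | no  _    = +-cancelʳ-≡ len u v (suc-injective eq)
... | yes u<lo | no  v≮lo = contradiction eq (m<n≤o⇒m≢1+o+p len u<lo (≮⇒≥ v≮lo))
... | no  u≮lo | yes v<lo = contradiction (sym eq) (m<n≤o⇒m≢1+o+p len v<lo (≮⇒≥ u≮lo))

module _ {ω} (c : Interval ω) {m} (room : m + suc (len c) ≤ ω) where

  outside : Fin m → Fin ω
  outside u = fromℕ< (skip-bounded (lo c) (len c) (toℕ<n u) room)

  outside-Outside : ∀ u → Outside c (outside u)
  outside-Outside u rewrite toℕ-fromℕ< (skip-bounded (lo c) (len c) (toℕ<n u) room) =
    skip-avoids (lo c) (len c) (toℕ u)

  outside-injective : Injective _≡_ _≡_ outside
  outside-injective eq = toℕ-injective (skip-injective (lo c) (len c) (fromℕ<-injective _ _ _ _ eq))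

ColourBound : ∀ {N} → Graph N → ℕ → ℕ → Set₁
ColourBound {N} G d n = ∀ {S : Pred (Fin N) 0ℓ} → Decidable S → BFreeIn G n d S →
                        ∀ w → ¬ CliqueIn G S (suc (suc w)) → ColourableIn G S (g d n (suc w))

module GapClasses {N} (G : Graph N) {S : Pred (Fin N) 0ℓ} (S? : Decidable S) (w : ℕ)
                 (Q : CliqueIn G S (suc (suc w))) (maximum : ¬ CliqueIn G S (suc (suc (suc w)))) where

  ω : ℕ
  ω = suc (suc w)

  q : Fin ω → Fin N
  q = member Q

  record HasGap (x : Fin N) (c : Interval ω) : Set where
    field
      off-clique   : ∀ s → x ≢ q s
      misses-first : adj G x (q (first c)) ≡ false
      misses-last  : adj G x (q (last c)) ≡ false
      sees-outside : ∀ {s} → Outside c s → adj G x (q s) ≡ true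

  open HasGap

  data Placement (x : Fin N) (c : Interval ω) : Set where
    on-clique : len c ≡ 0 → x ≡ q (first c) → Placement x c
    has-gap   : HasGap x c → Placement x c

  sees? : ∀ x → Decidable (λ s → adj G x (q s) ≡ true)
  sees? x s = adj G x (q s) Bool.≟ true

  gap : ∀ {x} → (∀ s → x ≢ q s) → ¬ (∀ s → adj G x (q s) ≡ true) → ∃ (HasGap x)
  gap {x} x∉Q misses-some
    with i , ¬xqi , before ← least-counterexample (sees? x) misses-some
       | j , ¬xqj , after  ← greatest-counterexample (sees? x) misses-some
    with c , first≡i , last≡j , bounds ← between i j (≮⇒≥ λ j<i → ¬xqj (before j j<i))
    = c , record
      { off-clique   = x∉Q
      ; misses-first = subst (λ s → adj G x (q s) ≡ false) (sym first≡i) (Bool.¬-not ¬xqi)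
      ; misses-last  = subst (λ s → adj G x (q s) ≡ false) (sym last≡j) (Bool.¬-not ¬xqj)
      ; sees-outside = λ s∉c → [ before _ , after _ ]′ (bounds s∉c)
      }

  place : ∀ {x} → S x → ∃ (Placement x)
  place {x} x∈S with any? (λ s → x ≟ᶠ q s)
  ... | yes (s , refl) with c , len≡0 , first≡s ← point s = c , on-clique len≡0 (cong q (sym first≡s))
  ... | no x∉Q with all? (sees? x)
  ...   | yes sees-all   = contradiction (joinCliques (singletonClique x∈S) Q (λ _ → sees-all)) maximum
  ...   | no misses-some = map₂ has-gap (gap (λ s x≡qs → x∉Q (s , x≡qs)) misses-some)

  classOf : Fin N → Interval ω
  classOf x with S? x
  ... | yes x∈S = proj₁ (place x∈S)
  ... | no  _   = zero , zero   -- vertices outside S get an arbitrary class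

  InClass : Interval ω → Pred (Fin N) 0ℓ
  InClass c = S ∩ λ x → classOf x ≡ c

  placement : ∀ {c x} → InClass c x → Placement x c
  placement {x = x} (x∈S , refl) with S? x
  ... | yes x∈S′ = proj₂ (place x∈S′)
  ... | no  x∉S  = contradiction x∈S x∉S

  adjacent⇒HasGap : ∀ {c x y} → InClass c x → InClass c y → adj G x y ≡ true → HasGap x c
  adjacent⇒HasGap x∈c y∈c xy with placement x∈c | placement y∈c
  ... | has-gap x-gap     | _                = x-gap
  ... | on-clique _ refl | on-clique _ refl = contradiction refl (adj⇒≢ G xy)
  ... | on-clique _ refl | has-gap y-gap    with () ← trans (sym (trans (adjSym G _ _) xy)) (misses-first y-gap)

  long⇒HasGap : ∀ {c x} → InClass c x → len c ≢ 0 → HasGap x c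
  long⇒HasGap x∈c len≢0 with placement x∈c
  ... | on-clique len≡0 _ = contradiction len≡0 len≢0
  ... | has-gap x-gap     = x-gap

  avoidingClique : ∀ c {m} → m + suc (len c) ≤ ω → CliqueIn G S m
  avoidingClique c room = record
    { member     = q ∘ outside c room
    ; member-adj = λ u≢v → member-adj Q (u≢v ∘ outside-injective c room)
    ; member-∈   = member-∈ Q ∘ outside c room
    }

  class-cliqueless : ∀ c → ¬ CliqueIn G (InClass c) (suc (suc (len c)))
  class-cliqueless c C =
    maximum (subst (CliqueIn G S) order (joinCliques (clique-⊆ proj₁ C) (avoidingClique c room) cross))
    where
    room : ω ∸ suc (len c) + suc (len c) ≤ ω
    room = ≤-reflexive (m∸n+n≡m (toℕ<n (proj₁ c)))
    order : suc (suc (len c)) + (ω ∸ suc (len c)) ≡ suc ω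
    order = cong suc (m+[n∸m]≡n (toℕ<n (proj₁ c)))
    gap-of-member : ∀ u → HasGap (member C u) c
    gap-of-member u =
      adjacent⇒HasGap (member-∈ C u) (member-∈ C (punchIn u zero))
                      (member-adj C (punchInᵢ≢i u zero ∘ sym))
    cross : ∀ u v → adj G (member C u) (q (outside c room v)) ≡ true
    cross u v = sees-outside (gap-of-member u) (outside-Outside c room v)

  module _ {d n} (2d+2≤n : 2 * suc (suc d) ≤ n) (free : BFreeIn G n (suc d) S) where

    class-BFree : ∀ c → len c ≢ 0 → BFreeIn G (reducedOrder d n ω (len c)) d (InClass c)
    class-BFree c len≢0 B B∈ e with refl ← InB-order B∈ =
      free (K m +ᴳ (K 2 ∪ᴳ B)) (step B B∈ (m≤n⊔m _ _) (reducedOrder≤ d (toℕ<n (proj₁ c)) 2d+2≤n))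
           (joinIn (clique⇒induced (avoidingClique c room)) endsAndB cross)
      where
      m : ℕ
      m = n ∸ reducedOrder d n ω (len c) ∸ 2
      room : m + suc (len c) ≤ ω
      room = reducedOrder-room d n (toℕ<n (proj₁ c))
      B-gap : ∀ v → HasGap (embed e v) c
      B-gap v = long⇒HasGap (embed-∈ e v) len≢0
      ends : CliqueIn G S 2
      ends = edgeClique (member-∈ Q (first c)) (member-∈ Q (last c)) (member-adj Q (first≢last c len≢0))
      ends-miss-B : ∀ u v → adj G (member ends u) (embed e v) ≡ false
      ends-miss-B zero       v = trans (adjSym G _ _) (misses-first (B-gap v))
      ends-miss-B (suc zero) v = trans (adjSym G _ _) (misses-last (B-gap v))
      ends-off-B : ∀ u v → member ends u ≢ embed e v
      ends-off-B zero       v eq = off-clique (B-gap v) _ (sym eq)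
      ends-off-B (suc zero) v eq = off-clique (B-gap v) _ (sym eq)
      endsAndB : InducedIn G S (K 2 ∪ᴳ B)
      endsAndB = combineIn false (clique⇒induced ends) (induced-⊆ proj₁ e) ends-miss-B ends-off-B
      cross : ∀ u i → adj G (q (outside c room u)) (embed endsAndB i) ≡ true
      cross u = [,]-splitAt-all 2 (λ y → adj G (q (outside c room u)) y ≡ true)
        (λ { zero → member-adj Q (Outside⇒≢first c (outside-Outside c room u))
           ; (suc zero) → member-adj Q (Outside⇒≢last c (outside-Outside c room u)) })
        (λ v → trans (adjSym G _ _) (sees-outside (B-gap v) (outside-Outside c room u)))

    module _ (IH : ∀ n′ → 2 * suc d ≤ n′ → ColourBound G d n′) where

      ClassColour : Interval ω → Set
      ClassColour c = Fin (g d (reducedOrder d n ω (len c)) (suc (len c)))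

      colourClass : ∀ c → ColouringIn G (InClass c) (ClassColour c)
      colourClass c@(zero , _)  =
        subst (ColourableIn G (InClass c)) (sym (g-one d _)) (edgeless-colourable (class-cliqueless c))
      colourClass c@(suc _ , _) =
        IH _ (m≤n⊔m _ _) (S? ∩? λ x → ≡-dec _≟ᶠ_ _≟ᶠ_ (classOf x) c) (class-BFree c λ ()) _
           (class-cliqueless c)

      encode : Σ (Interval ω) ClassColour → Fin (g (suc d) n ω)
      encode ((t , p) , i) = sumIndex (summand d n ω) id t (combineᶠ p i)

      encode-injective : Injective _≡_ _≡_ encode
      encode-injective {(t , p) , i} {(t′ , p′) , i′} eq
        with refl , same ← Σ-≡,≡←≡ (sumIndex-injective (summand d n ω) id
                                      {t} {t′} {combineᶠ p i} {combineᶠ p′ i′} eq)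
        with refl , refl ← combine-injective p i p′ i′ same = refl

      colourable : ColourableIn G S (g (suc d) n ω)
      colourable = recolour encode encode-injective (colourByClasses classOf colourClass)

module _ {N} (G : Graph N) where

  colourBound-zero : ∀ {n} → 2 ≤ n → ColourBound G 0 n
  colourBound-zero {suc (suc c)} _ S? free zero    noEdge = edgeless-colourable noEdge
  colourBound-zero {suc (suc c)} _ S? free (suc w) _      = greedy-colourable G S? (BFree⇒sparse G S? free)
  colourBound-zero {suc zero}    (s≤s ())

  colourBound-suc : ∀ {d n} → 2 * suc (suc d) ≤ n → (∀ n′ → 2 * suc d ≤ n′ → ColourBound G d n′) →
                    ColourBound G (suc d) n
  colourBound-suc _ IH S? free zero noEdge = edgeless-colourable noEdge
  colourBound-suc {d} {n} 2d+2≤n IH S? free (suc w) noBigger with hasCliqueIn? S? (suc (suc w))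
  ... | yes Q  = GapClasses.colourable G S? w Q noBigger 2d+2≤n free IH
  ... | no noQ = colourable-≤ (g-mono (suc d) w (≤-trans (2≤2*suc (suc d)) 2d+2≤n))
                              (colourBound-suc 2d+2≤n IH S? free w noQ)

colourBound : ∀ d n → 2 * suc d ≤ n → ∀ {N} (G : Graph N) → ColourBound G d n
colourBound zero    n 2≤n    G = colourBound-zero G 2≤n
colourBound (suc d) n 2d+2≤n G = colourBound-suc G 2d+2≤n λ n′ 2d≤n′ → colourBound d n′ 2d≤n′ G

clique⇒HasClique : ∀ {N} {G : Graph N} {S w} → CliqueIn G S w → HasClique G w
clique⇒HasClique C = member C , member-injective C , λ _ _ → member-adj C

BFree⇒BFreeIn : ∀ {n d N} {G : Graph N} → BFree n d G → BFreeIn G n d U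
BFree⇒BFreeIn free H H∈ e = free H H∈ (embed e , embed-injective e , embed-adj e)

mainTheorem7 : (d n : ℕ) → 2 * suc d ≤ n →
    ∀ {N} (G : Graph N) → BFree n d G →
    ∀ w → IsCliqueNumber G w → Colourable G (g d n w)
mainTheorem7 d n 2d≤n {zero}  G free zero    _             = (λ ()) , λ ()
mainTheorem7 d n 2d≤n {suc N} G free zero    (_ , noVertex) =
  contradiction (clique⇒HasClique (singletonClique {G = G} {S = U} {x = zero} tt)) noVertex
mainTheorem7 d n 2d≤n         G free (suc w) (_ , noBigger) =
  let κ = colourBound d n 2d≤n G U? (BFree⇒BFreeIn free) w (noBigger ∘ clique⇒HasClique)
  in colour κ , λ _ _ → proper κ tt tt
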